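{- Let $G$ be a connected cubic finite simple graph with vertex set $V(G)=\{v_1,\ldots,v_n\}$, and let $H:V(G)\rightarrow\{\{1\},\{0,2\}\}$. Let $G_L$ be the graph with vertex set $V(G)\cup\{x_1,\dots,x_n\}\cup\{y_1,\dots,y_n\}$ (the $x_i,y_i$ being $2n$ new distinct vertices) and edge set $E(G)\cup\{x_iy_i,\,y_iv_i,\,v_ix_i : i\in\{1,\dots,n\}\}$. Define $h_H:V(G_L)\rightarrow\{1,2\}$ by $h_H(u)=2$ if $u\in V(G)$ and $H(u)=\{0,2\}$, and $h_H(u)=1$ otherwise. Then $G$ contains an $H$-factor if and only if $G_L$ contains an $h_H$-factor.
   Context: For a set function $H$ assigning to each vertex $v$ of $G$ a set $H(v)$ of nonnegative integers, an $H$-factor of $G$ is a spanning subgraph $F$ of $G$ with $d_F(v)\in H(v)$ for every $v\in V(G)$. For a function $h:V(G)\rightarrow\mathbb{Z}_{\ge 0}$, an $h$-factor is a spanning subgraph $F$ with $d_F(v)=h(v)$ for every $v$. -}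

module Defs where

open import Data.Nat using (ℕ; zero; suc; _+_)
open import Data.Bool using (Bool; true; false; if_then_else_)
open import Data.Fin using (Fin; splitAt)
open import Data.Fin.Properties using (_≟_)
open import Data.List using (List; map; allFin)
open import Data.Nat.ListAction using (sum)
open import Data.Sum using (_⊎_; inj₁; inj₂)
open import Data.Product using (Σ; _×_)
open import Relation.Nullary.Decidable using (⌊_⌋)
open import Relation.Binary.PropositionalEquality using (_≡_)

Adjacency : ℕ → Set
Adjacency n = Fin n → Fin n → Bool

record SimpleGraph (n : ℕ) : Set where
  field
    adj    : Adjacency n
    sym    : ∀ u v → adj u v ≡ adj v u
    irrefl : ∀ v → adj v v ≡ false
open SimpleGraph public

deg : {n : ℕ} → Adjacency n → Fin n → ℕ
deg {n} A v = sum (map (λ w → if A v w then 1 else 0) (allFin n))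

IsSpanningSubgraph : {n : ℕ} → Adjacency n → Adjacency n → Set
IsSpanningSubgraph A F = (∀ u v → F u v ≡ F v u) × (∀ u v → F u v ≡ true → A u v ≡ true)

data Reach {n : ℕ} (A : Adjacency n) : Fin n → Fin n → Set where
  here : ∀ {u} → Reach A u u
  step : ∀ {u v w} → A u v ≡ true → Reach A v w → Reach A u w

Connected : {n : ℕ} → SimpleGraph n → Set
Connected G = ∀ u v → Reach (adj G) u v

Cubic : {n : ℕ} → SimpleGraph n → Set
Cubic G = ∀ v → deg (adj G) v ≡ 3

data HSet : Set where
  one     : HSet
  zeroTwo : HSet

_∈H_ : ℕ → HSet → Set
d ∈H one     = d ≡ 1
d ∈H zeroTwo = (d ≡ 0) ⊎ (d ≡ 2)

HasHFactor : {n : ℕ} → SimpleGraph n → (Fin n → HSet) → Set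
HasHFactor {n} G H = Σ (Adjacency n) λ F →
  IsSpanningSubgraph (adj G) F × (∀ v → deg F v ∈H H v)

HasExactFactor : {m : ℕ} → Adjacency m → (Fin m → ℕ) → Set
HasExactFactor {m} A h = Σ (Adjacency m) λ F →
  IsSpanningSubgraph A F × (∀ v → deg F v ≡ h v)

-- Vertices of G_L: Fin (n + (n + n)); first block = V(G) (v_i),
-- second block = x_i, third block = y_i.
data Layer (n : ℕ) : Set where
  vtx : Fin n → Layer n
  xv  : Fin n → Layer n
  yv  : Fin n → Layer n

layer : {n : ℕ} → Fin (n + (n + n)) → Layer n
layer {n} u with splitAt n u
... | inj₁ i = vtx i
... | inj₂ r with splitAt n r
...   | inj₁ i = xv i
...   | inj₂ i = yv i

adjL : {n : ℕ} → SimpleGraph n → Layer n → Layer n → Bool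
adjL G (vtx i) (vtx j) = adj G i j
adjL G (vtx i) (xv j)  = ⌊ i ≟ j ⌋
adjL G (vtx i) (yv j)  = ⌊ i ≟ j ⌋
adjL G (xv i)  (vtx j) = ⌊ i ≟ j ⌋
adjL G (xv i)  (xv j)  = false
adjL G (xv i)  (yv j)  = ⌊ i ≟ j ⌋
adjL G (yv i)  (vtx j) = ⌊ i ≟ j ⌋
adjL G (yv i)  (xv j)  = ⌊ i ≟ j ⌋
adjL G (yv i)  (yv j)  = false

GL : {n : ℕ} → SimpleGraph n → Adjacency (n + (n + n))
GL G u w = adjL G (layer u) (layer w)

hHL : {n : ℕ} → (Fin n → HSet) → Layer n → ℕ
hHL H (vtx i) with H i
... | one     = 1
... | zeroTwo = 2
hHL H (xv i) = 1
hHL H (yv i) = 1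

hH : {n : ℕ} → (Fin n → HSet) → Fin (n + (n + n)) → ℕ
hH H u = hHL H (layer u)

-- Each v_i of G lies in the triangle v_i x_i y_i of G_L, and x_i, y_i have no other
-- neighbours.  In an h_H-factor x_i and y_i have degree 1, so either the edge x_i y_i is
-- taken and neither pendant edge v_i x_i, v_i y_i is, or both pendant edges are taken and
-- x_i y_i is not.  Hence the factor restricted to G gives v_i degree h_H(v_i) or
-- h_H(v_i) - 2, i.e. a degree in H(v_i); conversely an H-factor extends by taking both
-- pendant edges exactly at the vertices with H(v) = {0,2} of degree 0.
module Submission where

open import Defs hiding (sym)
open import Data.Bool using (Bool; true; false; if_then_else_; _∧_; not)
open import Data.Bool.Properties using (∧-conicalˡ)
open import Data.Fin using (Fin; zero; suc; _↑ˡ_; _↑ʳ_)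
open import Data.Fin.Properties using (_≟_; splitAt-↑ˡ; splitAt-↑ʳ) renaming (suc-injective to fsuc-injective)
open import Data.List using (map; allFin)
open import Data.List.Properties using (map-tabulate; map-cong)
open import Data.Nat using (ℕ; zero; suc; _+_)
open import Data.Nat.ListAction using (sum)
open import Data.Nat.Properties using (+-assoc; +-comm; +-identityʳ; suc-injective)
open import Data.Product using (_×_; _,_)
open import Data.Sum using (inj₁; inj₂)
open import Function using (_∘_; id)
open import Relation.Nullary using (yes; no)
open import Relation.Nullary.Decidable using (⌊_⌋)
open import Relation.Binary.PropositionalEquality

ind : Bool → ℕ
ind b = if b then 1 else 0

count : {m : ℕ} → (Fin m → Bool) → ℕ
count {m} p = sum (map (ind ∘ p) (allFin m))

count-cong : ∀ {m} {p q : Fin m → Bool} → (∀ j → p j ≡ q j) → count p ≡ count q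
count-cong {m} p≗q = cong sum (map-cong (cong ind ∘ p≗q) (allFin m))

count-suc : ∀ {m} (p : Fin (suc m) → Bool) → count p ≡ ind (p zero) + count (p ∘ suc)
count-suc p = cong (λ xs → ind (p zero) + sum xs)
  (trans (map-tabulate suc (ind ∘ p)) (sym (map-tabulate id (ind ∘ p ∘ suc))))

count-none : ∀ {m} (p : Fin m → Bool) → (∀ j → p j ≡ false) → count p ≡ 0
count-none {zero}  p none = refl
count-none {suc m} p none =
  trans (count-suc p) (cong₂ _+_ (cong ind (none zero)) (count-none (p ∘ suc) (none ∘ suc)))

count-single : ∀ {m} (p : Fin m → Bool) (i : Fin m) →
               (∀ j → j ≢ i → p j ≡ false) → count p ≡ ind (p i)
count-single {suc m} p zero others = begin
  count p                     ≡⟨ count-suc p ⟩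
  ind (p zero) + count (p ∘ suc)
    ≡⟨ cong (ind (p zero) +_) (count-none (p ∘ suc) (λ j → others (suc j) λ ())) ⟩
  ind (p zero) + 0            ≡⟨ +-identityʳ _ ⟩
  ind (p zero)                ∎
  where open ≡-Reasoning
count-single {suc m} p (suc i) others =
  trans (count-suc p)
        (cong₂ _+_ (cong ind (others zero λ ()))
                   (count-single (p ∘ suc) i (λ j j≢i → others (suc j) (j≢i ∘ fsuc-injective))))

count-++ : ∀ m k (p : Fin (m + k) → Bool) →
           count p ≡ count (p ∘ (_↑ˡ k)) + count (p ∘ (m ↑ʳ_))
count-++ zero    k p = refl
count-++ (suc m) k p = begin
  count p                                                    ≡⟨ count-suc p ⟩
  ind (p zero) + count (p ∘ suc)                             ≡⟨ cong (ind (p zero) +_) (count-++ m k (p ∘ suc)) ⟩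
  ind (p zero) + (count (p ∘ suc ∘ (_↑ˡ k)) + count (p ∘ suc ∘ (m ↑ʳ_)))
    ≡⟨ sym (+-assoc (ind (p zero)) _ _) ⟩
  (ind (p zero) + count (p ∘ suc ∘ (_↑ˡ k))) + count (p ∘ (suc m ↑ʳ_))
    ≡⟨ cong (_+ count (p ∘ (suc m ↑ʳ_))) (sym (count-suc (p ∘ (_↑ˡ k)))) ⟩
  count (p ∘ (_↑ˡ k)) + count (p ∘ (suc m ↑ʳ_))              ∎
  where open ≡-Reasoning

⌊≟⌋-refl : ∀ {n} (i : Fin n) → ⌊ i ≟ i ⌋ ≡ true
⌊≟⌋-refl i = cong ⌊_⌋ (≡-≟-identity _≟_ refl)

⌊≟⌋-≢ : ∀ {n} {i j : Fin n} → j ≢ i → ⌊ i ≟ j ⌋ ≡ false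
⌊≟⌋-≢ j≢i = cong ⌊_⌋ (≢-≟-identity _≟_ (j≢i ∘ sym))

⌊≟⌋∧-sym : ∀ {n} (P : Fin n → Bool) (i j : Fin n) → ⌊ i ≟ j ⌋ ∧ P i ≡ ⌊ j ≟ i ⌋ ∧ P j
⌊≟⌋∧-sym P i j with i ≟ j
... | yes refl = cong (_∧ P i) (sym (⌊≟⌋-refl i))
... | no i≢j   = cong (_∧ P j) (sym (⌊≟⌋-≢ i≢j))

module _ {n : ℕ} where

  embed : Layer n → Fin (n + (n + n))
  embed (vtx i) = i ↑ˡ (n + n)
  embed (xv i)  = n ↑ʳ (i ↑ˡ n)
  embed (yv i)  = n ↑ʳ (n ↑ʳ i)

  layer-embed : ∀ l → layer (embed l) ≡ l
  layer-embed (vtx i) rewrite splitAt-↑ˡ n i (n + n) = refl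
  layer-embed (xv i)  rewrite splitAt-↑ʳ n (n + n) (i ↑ˡ n) | splitAt-↑ˡ n i n = refl
  layer-embed (yv i)  rewrite splitAt-↑ʳ n (n + n) (n ↑ʳ i) | splitAt-↑ʳ n n i = refl

  layerCount : (Layer n → Bool) → ℕ
  layerCount p = count (p ∘ vtx) + (count (p ∘ xv) + count (p ∘ yv))

  deg≡layerCount : (A : Adjacency (n + (n + n))) (u : Fin (n + (n + n))) →
                   deg A u ≡ layerCount (A u ∘ embed)
  deg≡layerCount A u =
    trans (count-++ n (n + n) (A u)) (cong (count (A u ∘ embed ∘ vtx) +_) (count-++ n n (A u ∘ (n ↑ʳ_))))

  deg-lift : (R : Layer n → Layer n → Bool) (u : Fin (n + (n + n))) →
             deg (λ u w → R (layer u) (layer w)) u ≡ layerCount (R (layer u))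
  deg-lift R u = trans (deg≡layerCount (λ u w → R (layer u) (layer w)) u)
    (cong₂ _+_ (count-cong (cong (R (layer u)) ∘ layer-embed ∘ vtx))
      (cong₂ _+_ (count-cong (cong (R (layer u)) ∘ layer-embed ∘ xv))
                 (count-cong (cong (R (layer u)) ∘ layer-embed ∘ yv))))

module TriangleDegrees {n : ℕ} (G : SimpleGraph n) (R : Layer n → Layer n → Bool)
                       (R⊆G : ∀ a b → R a b ≡ true → adjL G a b ≡ true) where

  R-off : ∀ a b → adjL G a b ≡ false → R a b ≡ false
  R-off a b non-edge with R a b | R⊆G a b
  ... | false | _ = refl
  ... | true  | edge with trans (sym (edge refl)) non-edge
  ...   | ()

  private
    only : ∀ a (f : Fin n → Layer n) i → (∀ j → j ≢ i → adjL G a (f j) ≡ false) →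
           count (R a ∘ f) ≡ ind (R a (f i))
    only a f i off = count-single (R a ∘ f) i (λ j j≢i → R-off a (f j) (off j j≢i))

    none : ∀ a (f : Fin n → Layer n) → (∀ j → adjL G a (f j) ≡ false) → count (R a ∘ f) ≡ 0
    none a f off = count-none (R a ∘ f) (λ j → R-off a (f j) (off j))

  layerCount-vtx : ∀ i → layerCount (R (vtx i)) ≡
                   (ind (R (vtx i) (xv i)) + ind (R (vtx i) (yv i))) + count (R (vtx i) ∘ vtx)
  layerCount-vtx i = trans
    (cong (count (R (vtx i) ∘ vtx) +_)
          (cong₂ _+_ (only (vtx i) xv i λ _ → ⌊≟⌋-≢) (only (vtx i) yv i λ _ → ⌊≟⌋-≢)))
    (+-comm (count (R (vtx i) ∘ vtx)) _)

  layerCount-xv : ∀ i → layerCount (R (xv i)) ≡ ind (R (xv i) (vtx i)) + ind (R (xv i) (yv i))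
  layerCount-xv i = cong₂ _+_ (only (xv i) vtx i λ _ → ⌊≟⌋-≢)
    (cong₂ _+_ (none (xv i) xv λ _ → refl) (only (xv i) yv i λ _ → ⌊≟⌋-≢))

  layerCount-yv : ∀ i → layerCount (R (yv i)) ≡ ind (R (yv i) (vtx i)) + ind (R (yv i) (xv i))
  layerCount-yv i = cong₂ _+_ (only (yv i) vtx i λ _ → ⌊≟⌋-≢)
    (trans (cong₂ _+_ (only (yv i) xv i λ _ → ⌊≟⌋-≢) (none (yv i) yv λ _ → refl)) (+-identityʳ _))

target : HSet → ℕ
target one     = 1
target zeroTwo = 2

hHL-vtx : ∀ {n} (H : Fin n → HSet) i → hHL H (vtx i) ≡ target (H i)
hHL-vtx H i with H i
... | one     = refl
... | zeroTwo = refl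

-- Whether a vertex of degree d in an H-factor takes both of its pendant edges.
padded : HSet → ℕ → Bool
padded one     _       = false
padded zeroTwo zero    = true
padded zeroTwo (suc _) = false

-- The pendant contribution is added on the left so that _+_ computes on it below.
padded-target : ∀ h d → d ∈H h → (ind (padded h d) + ind (padded h d)) + d ≡ target h
padded-target one     d       refl        = refl
padded-target zeroTwo zero    _           = refl
padded-target zeroTwo (suc d) (inj₂ refl) = refl

∈H-unpad : ∀ h d b → (ind b + ind b) + d ≡ target h → d ∈H h
∈H-unpad one     d false d≡1 = d≡1
∈H-unpad zeroTwo d false d≡2 = inj₂ d≡2
∈H-unpad zeroTwo d true  2+d≡2 = inj₁ (suc-injective (suc-injective 2+d≡2))
∈H-unpad one     d true  ()

ind-complement : ∀ b → ind b + ind (not b) ≡ 1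
ind-complement true  = refl
ind-complement false = refl

pendants-agree : ∀ a b c → ind a + ind c ≡ 1 → ind b + ind c ≡ 1 → a ≡ b
pendants-agree true  true  _     _  _  = refl
pendants-agree false false _     _  _  = refl
pendants-agree true  false true  () _
pendants-agree true  false false _  ()
pendants-agree false true  true  _  ()
pendants-agree false true  false () _

module HFactor⇒hFactor {n : ℕ} (G : SimpleGraph n) (H : Fin n → HSet) (F : Adjacency n)
                       (F-sym : ∀ u v → F u v ≡ F v u) (F⊆G : ∀ u v → F u v ≡ true → adj G u v ≡ true)
                       (F-deg : ∀ v → deg F v ∈H H v) where

  pad : Fin n → Bool
  pad i = padded (H i) (deg F i)

  FL : Layer n → Layer n → Bool
  FL (vtx i) (vtx j) = F i j
  FL (vtx i) (xv j)  = ⌊ i ≟ j ⌋ ∧ pad i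
  FL (vtx i) (yv j)  = ⌊ i ≟ j ⌋ ∧ pad i
  FL (xv i)  (vtx j) = ⌊ i ≟ j ⌋ ∧ pad i
  FL (xv i)  (xv j)  = false
  FL (xv i)  (yv j)  = ⌊ i ≟ j ⌋ ∧ not (pad i)
  FL (yv i)  (vtx j) = ⌊ i ≟ j ⌋ ∧ pad i
  FL (yv i)  (xv j)  = ⌊ i ≟ j ⌋ ∧ not (pad i)
  FL (yv i)  (yv j)  = false

  FL-sym : ∀ a b → FL a b ≡ FL b a
  FL-sym (vtx i) (vtx j) = F-sym i j
  FL-sym (vtx i) (xv j)  = ⌊≟⌋∧-sym pad i j
  FL-sym (vtx i) (yv j)  = ⌊≟⌋∧-sym pad i j
  FL-sym (xv i)  (vtx j) = ⌊≟⌋∧-sym pad i j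
  FL-sym (xv i)  (xv j)  = refl
  FL-sym (xv i)  (yv j)  = ⌊≟⌋∧-sym (not ∘ pad) i j
  FL-sym (yv i)  (vtx j) = ⌊≟⌋∧-sym pad i j
  FL-sym (yv i)  (xv j)  = ⌊≟⌋∧-sym (not ∘ pad) i j
  FL-sym (yv i)  (yv j)  = refl

  FL⊆GL : ∀ a b → FL a b ≡ true → adjL G a b ≡ true
  FL⊆GL (vtx i) (vtx j) e = F⊆G i j e
  FL⊆GL (vtx i) (xv j)  e = ∧-conicalˡ _ _ e
  FL⊆GL (vtx i) (yv j)  e = ∧-conicalˡ _ _ e
  FL⊆GL (xv i)  (vtx j) e = ∧-conicalˡ _ _ e
  FL⊆GL (xv i)  (yv j)  e = ∧-conicalˡ _ _ e
  FL⊆GL (yv i)  (vtx j) e = ∧-conicalˡ _ _ e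
  FL⊆GL (yv i)  (xv j)  e = ∧-conicalˡ _ _ e

  open TriangleDegrees G FL FL⊆GL

  diag : ∀ (i : Fin n) b → ind (⌊ i ≟ i ⌋ ∧ b) ≡ ind b
  diag i b = cong (λ t → ind (t ∧ b)) (⌊≟⌋-refl i)

  FL-deg : ∀ l → layerCount (FL l) ≡ hHL H l
  FL-deg (vtx i) = begin
    layerCount (FL (vtx i))                        ≡⟨ layerCount-vtx i ⟩
    (ind (⌊ i ≟ i ⌋ ∧ pad i) + ind (⌊ i ≟ i ⌋ ∧ pad i)) + deg F i
      ≡⟨ cong (_+ deg F i) (cong₂ _+_ (diag i (pad i)) (diag i (pad i))) ⟩
    (ind (pad i) + ind (pad i)) + deg F i          ≡⟨ padded-target (H i) (deg F i) (F-deg i) ⟩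
    target (H i)                                   ≡⟨ sym (hHL-vtx H i) ⟩
    hHL H (vtx i)                                  ∎
    where open ≡-Reasoning
  FL-deg (xv i) = trans (layerCount-xv i)
    (trans (cong₂ _+_ (diag i (pad i)) (diag i (not (pad i)))) (ind-complement (pad i)))
  FL-deg (yv i) = trans (layerCount-yv i)
    (trans (cong₂ _+_ (diag i (pad i)) (diag i (not (pad i)))) (ind-complement (pad i)))

  hFactor : HasExactFactor (GL G) (hH H)
  hFactor = (λ u w → FL (layer u) (layer w))
          , ((λ u w → FL-sym (layer u) (layer w)) , (λ u w → FL⊆GL (layer u) (layer w)))
          , (λ u → trans (deg-lift FL u) (FL-deg (layer u)))

module hFactor⇒HFactor {n : ℕ} (G : SimpleGraph n) (H : Fin n → HSet) (F : Adjacency (n + (n + n)))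
                       (F-sym : ∀ u v → F u v ≡ F v u) (F⊆GL : ∀ u v → F u v ≡ true → GL G u v ≡ true)
                       (F-deg : ∀ v → deg F v ≡ hH H v) where

  FL : Layer n → Layer n → Bool
  FL a b = F (embed a) (embed b)

  FL⊆GL : ∀ a b → FL a b ≡ true → adjL G a b ≡ true
  FL⊆GL a b e = subst₂ (λ a′ b′ → adjL G a′ b′ ≡ true) (layer-embed a) (layer-embed b) (F⊆GL _ _ e)

  FL-deg : ∀ l → layerCount (FL l) ≡ hHL H l
  FL-deg l = trans (sym (deg≡layerCount {n} F (embed l))) (trans (F-deg (embed l)) (cong (hHL H) (layer-embed l)))

  open TriangleDegrees G FL FL⊆GL

  FG : Adjacency n
  FG i j = FL (vtx i) (vtx j)

  pendants-agree-at : ∀ i → FL (vtx i) (xv i) ≡ FL (vtx i) (yv i)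
  pendants-agree-at i = pendants-agree _ _ (FL (xv i) (yv i))
    (trans (cong (λ t → ind t + ind (FL (xv i) (yv i))) (F-sym _ _))
           (trans (sym (layerCount-xv i)) (FL-deg (xv i))))
    (trans (cong₂ (λ s t → ind s + ind t) (F-sym _ _) (F-sym _ _))
           (trans (sym (layerCount-yv i)) (FL-deg (yv i))))

  FG-deg : ∀ i → deg FG i ∈H H i
  FG-deg i = ∈H-unpad (H i) (deg FG i) (FL (vtx i) (xv i)) (begin
    (ind (FL (vtx i) (xv i)) + ind (FL (vtx i) (xv i))) + deg FG i
      ≡⟨ cong (λ t → (ind (FL (vtx i) (xv i)) + ind t) + deg FG i) (pendants-agree-at i) ⟩
    (ind (FL (vtx i) (xv i)) + ind (FL (vtx i) (yv i))) + deg FG i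
      ≡⟨ sym (layerCount-vtx i) ⟩
    layerCount (FL (vtx i))  ≡⟨ FL-deg (vtx i) ⟩
    hHL H (vtx i)            ≡⟨ hHL-vtx H i ⟩
    target (H i)             ∎)
    where open ≡-Reasoning

  HFactor : HasHFactor G H
  HFactor = FG , ((λ i j → F-sym _ _) , (λ i j → FL⊆GL (vtx i) (vtx j))) , FG-deg

lemma2p4 : (n : ℕ) (G : SimpleGraph n) → Connected G → Cubic G →
           (H : Fin n → HSet) →
           (HasHFactor G H → HasExactFactor (GL G) (hH H)) ×
           (HasExactFactor (GL G) (hH H) → HasHFactor G H)
lemma2p4 n G _ _ H =
  (λ (F , (F-sym , F⊆G) , F-deg) → HFactor⇒hFactor.hFactor G H F F-sym F⊆G F-deg) ,
  (λ (F , (F-sym , F⊆GL) , F-deg) → hFactor⇒HFactor.HFactor G H F F-sym F⊆GL F-deg)
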